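{- Let $P=(X,\prec)$ be a poset on $|X|=n$ elements. Then $\Omega(P,t)=e(P)\,\frac{t^n}{n!}$ for some positive integer $t$ if and only if $P$ is an $n$-antichain (no two distinct elements are comparable).
   Context: $\Omega(P,t)$ is the number of maps $g:X\to[t]$ with $g(x)\le g(y)$ whenever $x\prec y$; $e(P)$ is the number of linear extensions of $P$ (bijections $f:X\to[n]$ with $f(x)<f(y)$ whenever $x\prec y$). -}

module Defs where

open import Level using (0ℓ)
open import Data.Nat using (ℕ; zero; suc)
open import Data.Fin using (Fin; _≤_; _<_) renaming (_≟_ to _≟ᶠ_)
open import Data.Fin.Properties using (all?; any?) renaming (_≤?_ to _≤?ᶠ_; _<?_ to _<?ᶠ_)
open import Data.Fin.Base using (zero; suc)
open import Data.List using (List; []; _∷_; map; concatMap; length; filter)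
open import Data.List using () renaming ([_] to ⟦_⟧)
open import Data.List.Base using (allFin)
open import Data.Product using (∃; _×_)
open import Relation.Binary.Core using (Rel)
open import Relation.Binary.Definitions using (Decidable)
open import Relation.Binary.PropositionalEquality using (_≡_)
open import Relation.Nullary using (Dec; ¬_)
open import Relation.Nullary.Decidable using (_→-dec_; _×-dec_)

cons : ∀ {n t} → Fin t → (Fin n → Fin t) → Fin (suc n) → Fin t
cons a f zero = a
cons a f (suc i) = f i

allFunctions : (n t : ℕ) → List (Fin n → Fin t)
allFunctions zero t = ⟦ (λ ()) ⟧
allFunctions (suc n) t =
  concatMap (λ a → map (cons a) (allFunctions n t)) (allFin t)

module _ {n : ℕ} (_≺_ : Rel (Fin n) 0ℓ) (_≺?_ : Decidable _≺_) where

  OrderPreserving : ∀ {t} → (Fin n → Fin t) → Set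
  OrderPreserving g = ∀ x y → x ≺ y → g x ≤ g y

  orderPreserving? : ∀ {t} (g : Fin n → Fin t) → Dec (OrderPreserving g)
  orderPreserving? g =
    all? λ x → all? λ y → (x ≺? y) →-dec (g x ≤?ᶠ g y)

  Ω : ℕ → ℕ
  Ω t = length (filter orderPreserving? (allFunctions n t))

  Injective : (Fin n → Fin n) → Set
  Injective f = ∀ x y → f x ≡ f y → x ≡ y

  Surjective : (Fin n → Fin n) → Set
  Surjective f = ∀ y → ∃ λ x → f x ≡ y

  LinearExtension : (Fin n → Fin n) → Set
  LinearExtension f =
    (Injective f × Surjective f) × (∀ x y → x ≺ y → f x < f y)

  linearExtension? : (f : Fin n → Fin n) → Dec (LinearExtension f)
  linearExtension? f =
    ((all? λ x → all? λ y → (f x ≟ᶠ f y) →-dec (x ≟ᶠ y))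
      ×-dec (all? λ y → any? λ x → f x ≟ᶠ y))
    ×-dec (all? λ x → all? λ y → (x ≺? y) →-dec (f x <?ᶠ f y))

  e : ℕ
  e = length (filter linearExtension? (allFunctions n n))

  Antichain : Set
  Antichain = ∀ x y → ¬ (x ≡ y) → ¬ (x ≺ y)

{-# OPTIONS --safe #-}
-- Count pairs (g, π) of a map g : X → [t] and a permutation π of X, sorting X by the value of g
-- with ties broken by π.  Every permutation f arises as the sorted order of exactly tⁿ pairs: the
-- fibres over f and over the identity correspond by relabelling X along f, and together the n!
-- fibres cover all tⁿ·n! pairs.  Summing the indicator of "the sorted order is a linear extension"
-- therefore gives e(P)·tⁿ, and since the sorted order can only be a linear extension when g is
-- order preserving, e(P)·tⁿ ≤ Ω(P,t)·n!.  If a ≺ b, a constant g together with a π putting b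
-- before a is order preserving but sorts b first, so the inequality is strict for every t ≥ 1.
-- For an antichain, t = 1 gives Ω = 1 and e = n!.
module Submission where

open import Defs
  using ( cons; allFunctions; OrderPreserving; orderPreserving?; LinearExtension; linearExtension?
        ; Ω; e; Antichain )
open import Level using (0ℓ)
open import Data.Bool using (true; false; if_then_else_)
open import Data.Nat using (ℕ; zero; suc; pred; _+_; _*_; _∸_; _^_; _!; _≤_; _<_; _≥_; z≤n; s≤s)
open import Data.Nat.Properties
  using ( +-identityʳ; +-assoc; +-mono-≤; +-mono-<-≤; +-mono-≤-<; +-commutativeSemigroup
        ; *-zeroʳ; *-distribˡ-+; *-comm; *-assoc; *-identityˡ; *-identityʳ; *-monoʳ-≤; *-cancelˡ-≡
        ; ≤-reflexive; ≤-trans; <-irrefl; <-asym; <⇒≤; <-cmp; <-strictTotalOrder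
        ; ∸-monoʳ-<; pred[m∸n]≡m∸[1+n]; ^-zeroˡ; _!≢0; module ≤-Reasoning )
open import Algebra.Properties.CommutativeSemigroup +-commutativeSemigroup
  using () renaming (interchange to +-interchange)
open import Data.Fin as Fin using (Fin; zero; suc; toℕ; fromℕ<; punchOut; opposite; _≟_)
open import Data.Fin.Properties
  using ( any?; suc-injective; punchOut-injective; injective⇒≤; toℕ-fromℕ<; toℕ-injective; fromℕ<-cong
        ; toℕ<n; toℕ≤pred[n]; opposite-prop; opposite-involutive )
open import Data.Fin.Subset using (Subset; inside; outside; _∈_; _∉_; _∪_; ⁅_⁆; ∣_∣; ⊥; ∁)
open import Data.Fin.Subset.Properties
  using (_∈?_; ∉⊥; ∣⊥∣≡0; ∣∁p∣≡n∸∣p∣; x∈p∪q⁺; x∈p∪q⁻; x∈⁅x⁆; x∈⁅y⁆⇒x≡y; x∉p⇒x∈∁p; x∈∁p⇒x∉p; ∪-identityʳ)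
open import Data.List using (List; []; _∷_; map; concatMap; length; filter; _++_; allFin; tabulate)
open import Data.List.Properties using (map-tabulate; length-tabulate)
open import Data.List.Membership.Propositional using (lose)
open import Data.List.Membership.Propositional.Properties using (∈-allFin)
open import Data.List.Relation.Unary.Any as Any using (Any; here; there)
open import Data.Product using (∃; ∃-syntax; _×_; _,_; proj₁; proj₂; uncurry)
open import Data.Product.Relation.Binary.Lex.Strict using (×-strictTotalOrder)
open import Data.Sum using (inj₁; inj₂)
open import Data.Vec using (_∷_; []; here; there)
open import Function using (_∘_; id; _⇔_; mk⇔; Equivalence)
open import Function.Definitions using (Injective)
open import Relation.Binary.Bundles using (StrictTotalOrder)
open import Relation.Binary.Core using (Rel; _Preserves_⟶_)
open import Relation.Binary.Definitions using (Decidable; Trichotomous; tri<; tri≈; tri>)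
open import Relation.Binary.Structures using (IsStrictPartialOrder)
open import Relation.Binary.PropositionalEquality
open import Relation.Nullary using (Dec; yes; no; does; ¬_; ¬?; contradiction)
open import Relation.Nullary.Decidable using (_×-dec_; map′; dec-true; dec-false; does-⇔)
import Relation.Nullary.Decidable as Dec

𝟙 : {P : Set} → Dec P → ℕ
𝟙 p = if does p then 1 else 0

private variable
  P Q : Set

𝟙-yes : (p : Dec P) → P → 𝟙 p ≡ 1
𝟙-yes p x = cong (λ b → if b then 1 else 0) (dec-true p x)

𝟙-no : (p : Dec P) → ¬ P → 𝟙 p ≡ 0
𝟙-no p x = cong (λ b → if b then 1 else 0) (dec-false p x)

𝟙-⇔ : P ⇔ Q → (p : Dec P) (q : Dec Q) → 𝟙 p ≡ 𝟙 q
𝟙-⇔ P⇔Q p q = cong (λ b → if b then 1 else 0) (does-⇔ P⇔Q p q)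

𝟙-× : (p : Dec P) (q : Dec Q) → 𝟙 (p ×-dec q) ≡ 𝟙 p * 𝟙 q
𝟙-× (yes _) q = sym (+-identityʳ (𝟙 q))
𝟙-× (no _)  q = refl

𝟙≤1 : (p : Dec P) → 𝟙 p ≤ 1
𝟙≤1 (yes _) = s≤s z≤n
𝟙≤1 (no _)  = z≤n

𝟙-mono-≤ : (P → Q) → (p : Dec P) (q : Dec Q) → 𝟙 p ≤ 𝟙 q
𝟙-mono-≤ P→Q (yes x) q = ≤-reflexive (sym (𝟙-yes q (P→Q x)))
𝟙-mono-≤ P→Q (no _)  q = z≤n

𝟙-*-cong : (p : Dec P) {m n : ℕ} → (P → m ≡ n) → 𝟙 p * m ≡ 𝟙 p * n
𝟙-*-cong (yes x) m≡n = cong (1 *_) (m≡n x)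
𝟙-*-cong (no _)  m≡n = refl

𝟙-*-mono-≤ : (p : Dec P) {m n : ℕ} → (P → m ≤ n) → 𝟙 p * m ≤ 𝟙 p * n
𝟙-*-mono-≤ (yes x) m≤n = *-monoʳ-≤ 1 (m≤n x)
𝟙-*-mono-≤ (no _)  m≤n = z≤n

∑ : {A : Set} → List A → (A → ℕ) → ℕ
∑ []       f = 0
∑ (x ∷ xs) f = f x + ∑ xs f

syntax ∑ xs (λ x → e) = ∑[ x ∈ xs ] e

module _ {A : Set} where
  ∑-cong : (xs : List A) {f g : A → ℕ} → f ≗ g → ∑ xs f ≡ ∑ xs g
  ∑-cong []       f≗g = refl
  ∑-cong (x ∷ xs) f≗g = cong₂ _+_ (f≗g x) (∑-cong xs f≗g)

  ∑-mono-≤ : (xs : List A) {f g : A → ℕ} → (∀ x → f x ≤ g x) → ∑ xs f ≤ ∑ xs g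
  ∑-mono-≤ []       f≤g = z≤n
  ∑-mono-≤ (x ∷ xs) f≤g = +-mono-≤ (f≤g x) (∑-mono-≤ xs f≤g)

  ∑-mono-< : {xs : List A} {f g : A → ℕ} → (∀ x → f x ≤ g x) →
             Any (λ x → f x < g x) xs → ∑ xs f < ∑ xs g
  ∑-mono-< {x ∷ xs} f≤g (here fx<gx)  = +-mono-<-≤ fx<gx (∑-mono-≤ xs f≤g)
  ∑-mono-< {x ∷ xs} f≤g (there f<g)   = +-mono-≤-< (f≤g x) (∑-mono-< f≤g f<g)

  ∑-++ : (xs ys : List A) (f : A → ℕ) → ∑ (xs ++ ys) f ≡ ∑ xs f + ∑ ys f
  ∑-++ []       ys f = refl
  ∑-++ (x ∷ xs) ys f = trans (cong (f x +_) (∑-++ xs ys f)) (sym (+-assoc (f x) _ _))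

  ∑-+ : (xs : List A) (f g : A → ℕ) → ∑[ x ∈ xs ] (f x + g x) ≡ ∑ xs f + ∑ xs g
  ∑-+ []       f g = refl
  ∑-+ (x ∷ xs) f g = trans (cong (f x + g x +_) (∑-+ xs f g))
                           (+-interchange (f x) (g x) (∑ xs f) (∑ xs g))

  ∑-*ˡ : (xs : List A) (c : ℕ) (f : A → ℕ) → ∑[ x ∈ xs ] (c * f x) ≡ c * ∑ xs f
  ∑-*ˡ []       c f = sym (*-zeroʳ c)
  ∑-*ˡ (x ∷ xs) c f = trans (cong (c * f x +_) (∑-*ˡ xs c f)) (sym (*-distribˡ-+ c (f x) (∑ xs f)))

  ∑-*ʳ : (xs : List A) (c : ℕ) (f : A → ℕ) → ∑[ x ∈ xs ] (f x * c) ≡ ∑ xs f * c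
  ∑-*ʳ xs c f = trans (∑-cong xs (λ x → *-comm (f x) c)) (trans (∑-*ˡ xs c f) (*-comm c (∑ xs f)))

  ∑-const : (xs : List A) (c : ℕ) → ∑[ _ ∈ xs ] c ≡ length xs * c
  ∑-const []       c = refl
  ∑-const (x ∷ xs) c = cong (c +_) (∑-const xs c)

  ∑-zero : (xs : List A) → ∑[ _ ∈ xs ] 0 ≡ 0
  ∑-zero xs = trans (∑-const xs 0) (*-zeroʳ (length xs))

  ∑-pos : (xs : List A) {f : A → ℕ} → 0 < ∑ xs f → Any (λ x → 0 < f x) xs
  ∑-pos (x ∷ xs) {f} 0<∑ with f x in fx≡
  ... | zero  = there (∑-pos xs 0<∑)
  ... | suc _ = here (subst (0 <_) (sym fx≡) (s≤s z≤n))

  length-filter : (xs : List A) {P : A → Set} (P? : ∀ x → Dec (P x)) →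
                  length (filter P? xs) ≡ ∑[ x ∈ xs ] 𝟙 (P? x)
  length-filter []       P? = refl
  length-filter (x ∷ xs) P? with does (P? x)
  ... | true  = cong suc (length-filter xs P?)
  ... | false = length-filter xs P?

module _ {A B : Set} where
  ∑-map : (xs : List A) (h : A → B) (f : B → ℕ) → ∑ (map h xs) f ≡ ∑ xs (f ∘ h)
  ∑-map []       h f = refl
  ∑-map (x ∷ xs) h f = cong (f (h x) +_) (∑-map xs h f)

  ∑-concatMap : (xs : List A) (h : A → List B) (f : B → ℕ) →
                ∑ (concatMap h xs) f ≡ ∑[ x ∈ xs ] ∑ (h x) f
  ∑-concatMap []       h f = refl
  ∑-concatMap (x ∷ xs) h f = trans (∑-++ (h x) _ f) (cong (∑ (h x) f +_) (∑-concatMap xs h f))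

  ∑-comm : (xs : List A) (ys : List B) (F : A → B → ℕ) →
           ∑[ x ∈ xs ] ∑[ y ∈ ys ] F x y ≡ ∑[ y ∈ ys ] ∑[ x ∈ xs ] F x y
  ∑-comm []       ys F = sym (∑-zero ys)
  ∑-comm (x ∷ xs) ys F = trans (cong (∑ ys (F x) +_) (∑-comm xs ys F))
                               (sym (∑-+ ys (F x) (λ y → ∑[ x ∈ xs ] F x y)))

length≡∑ : {A : Set} (xs : List A) → length xs ≡ ∑[ _ ∈ xs ] 1
length≡∑ xs = sym (trans (∑-const xs 1) (*-identityʳ (length xs)))

module Enumeration {A : Set} {_≈_ : Rel A 0ℓ} (_≈?_ : Decidable _≈_) (xs : List A)
                   (∑-once : ∀ x → ∑[ y ∈ xs ] 𝟙 (y ≈? x) ≡ 1) where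

  ∑-select : (F : A → ℕ) → F Preserves _≈_ ⟶ _≡_ →
             ∀ x → ∑[ y ∈ xs ] (𝟙 (y ≈? x) * F y) ≡ F x
  ∑-select F F-resp x = begin
    ∑[ y ∈ xs ] (𝟙 (y ≈? x) * F y) ≡⟨ ∑-cong xs (λ y → 𝟙-*-cong (y ≈? x) F-resp) ⟩
    ∑[ y ∈ xs ] (𝟙 (y ≈? x) * F x) ≡⟨ ∑-*ʳ xs (F x) (λ y → 𝟙 (y ≈? x)) ⟩
    ∑[ y ∈ xs ] 𝟙 (y ≈? x) * F x   ≡⟨ cong (_* F x) (∑-once x) ⟩
    1 * F x                        ≡⟨ *-identityˡ (F x) ⟩
    F x                            ∎
    where open ≡-Reasoning

  ∑-reindex : (F : A → ℕ) → F Preserves _≈_ ⟶ _≡_ → (σ τ : A → A) →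
              (∀ x y → x ≈ σ y ⇔ y ≈ τ x) → ∑[ y ∈ xs ] F (σ y) ≡ ∑ xs F
  ∑-reindex F F-resp σ τ σ⇔τ = begin
    ∑[ y ∈ xs ] F (σ y)                             ≡⟨ ∑-cong xs (λ y → ∑-select F F-resp (σ y)) ⟨
    ∑[ y ∈ xs ] ∑[ x ∈ xs ] (𝟙 (x ≈? σ y) * F x)   ≡⟨ ∑-comm xs xs _ ⟩
    ∑[ x ∈ xs ] ∑[ y ∈ xs ] (𝟙 (x ≈? σ y) * F x)   ≡⟨ ∑-cong xs (λ x → ∑-*ʳ xs (F x) _) ⟩
    ∑[ x ∈ xs ] (∑[ y ∈ xs ] 𝟙 (x ≈? σ y) * F x)   ≡⟨ ∑-cong xs (λ x → cong (_* F x) (∑-τ x)) ⟩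
    ∑[ x ∈ xs ] (1 * F x)                           ≡⟨ ∑-cong xs (λ x → *-identityˡ (F x)) ⟩
    ∑ xs F                                          ∎
    where
    open ≡-Reasoning
    ∑-τ : ∀ x → ∑[ y ∈ xs ] 𝟙 (x ≈? σ y) ≡ 1
    ∑-τ x = trans (∑-cong xs (λ y → 𝟙-⇔ (σ⇔τ x y) (x ≈? σ y) (y ≈? τ x))) (∑-once (τ x))

  ∈-enumeration : ∀ x → Any (_≈ x) xs
  ∈-enumeration x = Any.map related (∑-pos xs (subst (0 <_) (sym (∑-once x)) (s≤s z≤n)))
    where
    related : ∀ {y} → 0 < 𝟙 (y ≈? x) → y ≈ x
    related {y} 0<𝟙 with y ≈? x
    ... | yes y≈x = y≈x

∑-allFin-suc : ∀ {n} (f : Fin (suc n) → ℕ) →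
               ∑ (allFin (suc n)) f ≡ f zero + ∑[ i ∈ allFin n ] f (suc i)
∑-allFin-suc {n} f = cong (f zero +_) (begin
  ∑ (tabulate suc) f           ≡⟨ cong (λ is → ∑ is f) (map-tabulate id suc) ⟨
  ∑ (map suc (allFin n)) f     ≡⟨ ∑-map (allFin n) suc f ⟩
  ∑[ i ∈ allFin n ] f (suc i)  ∎)
  where open ≡-Reasoning

∑-allFin-once : ∀ {n} (x : Fin n) → ∑[ y ∈ allFin n ] 𝟙 (y ≟ x) ≡ 1
∑-allFin-once {suc n} zero    = trans (∑-allFin-suc {n} (λ y → 𝟙 (y ≟ zero))) (cong suc (∑-zero (allFin n)))
∑-allFin-once {suc n} (suc x) = trans (∑-allFin-suc {n} (λ y → 𝟙 (y ≟ suc x))) (∑-allFin-once x)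

module Fins {n : ℕ} = Enumeration (_≟_ {n}) (allFin n) ∑-allFin-once

-- By recursion rather than through all?, so that 𝟙 (cons a g ≗? h) unfolds
-- to 𝟙 (a ≟ h zero) * 𝟙 (g ≗? h ∘ suc).
_≗?_ : ∀ {n t} → Decidable {A = Fin n → Fin t} _≗_
_≗?_ {zero}  f g = yes λ ()
_≗?_ {suc n} f g = map′ (uncurry ≗-cons) (λ f≗g → f≗g zero , f≗g ∘ suc)
                        (f zero ≟ g zero ×-dec (f ∘ suc) ≗? (g ∘ suc))
  where
  ≗-cons : f zero ≡ g zero → f ∘ suc ≗ g ∘ suc → f ≗ g
  ≗-cons eq _  zero    = eq
  ≗-cons _  eq (suc i) = eq i

∑-allFunctions-suc : ∀ {n t} (F : (Fin (suc n) → Fin t) → ℕ) →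
                     ∑ (allFunctions (suc n) t) F ≡ ∑[ a ∈ allFin t ] ∑[ g ∈ allFunctions n t ] F (cons a g)
∑-allFunctions-suc {n} {t} F = trans
  (∑-concatMap (allFin t) (λ a → map (cons a) (allFunctions n t)) F)
  (∑-cong (allFin t) (λ a → ∑-map (allFunctions n t) (cons a) F))

∑-allFunctions-once : ∀ {n t} (h : Fin n → Fin t) → ∑[ g ∈ allFunctions n t ] 𝟙 (g ≗? h) ≡ 1
∑-allFunctions-once {zero}      h = refl
∑-allFunctions-once {suc n} {t} h = begin
  ∑[ g ∈ allFunctions (suc n) t ] 𝟙 (g ≗? h)
    ≡⟨ ∑-allFunctions-suc (λ g → 𝟙 (g ≗? h)) ⟩
  ∑[ a ∈ allFin t ] ∑[ g ∈ allFunctions n t ] 𝟙 ((a ≟ h zero) ×-dec (g ≗? (h ∘ suc)))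
    ≡⟨ ∑-cong (allFin t) (λ a → ∑-cong (allFunctions n t) (λ g → 𝟙-× (a ≟ h zero) (g ≗? (h ∘ suc)))) ⟩
  ∑[ a ∈ allFin t ] ∑[ g ∈ allFunctions n t ] (𝟙 (a ≟ h zero) * 𝟙 (g ≗? (h ∘ suc)))
    ≡⟨ ∑-cong (allFin t) (λ a → ∑-*ˡ (allFunctions n t) (𝟙 (a ≟ h zero)) _) ⟩
  ∑[ a ∈ allFin t ] (𝟙 (a ≟ h zero) * ∑[ g ∈ allFunctions n t ] 𝟙 (g ≗? (h ∘ suc)))
    ≡⟨ ∑-cong (allFin t) (λ a → cong (𝟙 (a ≟ h zero) *_) (∑-allFunctions-once (h ∘ suc))) ⟩
  ∑[ a ∈ allFin t ] (𝟙 (a ≟ h zero) * 1)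
    ≡⟨ ∑-*ʳ (allFin t) 1 (λ a → 𝟙 (a ≟ h zero)) ⟩
  ∑[ a ∈ allFin t ] 𝟙 (a ≟ h zero) * 1
    ≡⟨ cong (_* 1) (∑-allFin-once (h zero)) ⟩
  1 ∎
  where open ≡-Reasoning

module Functions {n t : ℕ} = Enumeration (_≗?_ {n} {t}) (allFunctions n t) ∑-allFunctions-once

length-allFunctions : ∀ n t → length (allFunctions n t) ≡ t ^ n
length-allFunctions zero    t = refl
length-allFunctions (suc n) t = begin
  length (allFunctions (suc n) t)
    ≡⟨ length≡∑ (allFunctions (suc n) t) ⟩
  ∑[ _ ∈ allFunctions (suc n) t ] 1
    ≡⟨ ∑-allFunctions-suc {n} {t} (λ _ → 1) ⟩
  ∑[ _ ∈ allFin t ] ∑[ _ ∈ allFunctions n t ] 1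
    ≡⟨ ∑-cong (allFin t) (λ _ → length≡∑ (allFunctions n t)) ⟨
  ∑[ _ ∈ allFin t ] length (allFunctions n t)
    ≡⟨ ∑-const (allFin t) _ ⟩
  length (allFin t) * length (allFunctions n t)
    ≡⟨ cong₂ _*_ (length-tabulate {n = t} id) (length-allFunctions n t) ⟩
  t * t ^ n ∎
  where open ≡-Reasoning

injective⇒surjective : ∀ {n} {f : Fin n → Fin n} → Injective _≡_ _≡_ f → ∀ y → ∃ λ x → f x ≡ y
injective⇒surjective {suc m} {f} f-inj y with any? (λ x → f x ≟ y)
... | yes found = found
... | no ¬found = contradiction (injective⇒≤ punchOut∘f-injective) (<-irrefl refl)
  where
  y≢f : ∀ x → y ≢ f x
  y≢f x y≡fx = ¬found (x , sym y≡fx)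
  punchOut∘f-injective : Injective _≡_ _≡_ (λ x → punchOut (y≢f x))
  punchOut∘f-injective = f-inj ∘ punchOut-injective (y≢f _) (y≢f _)

-- Counting injections

InjectionAvoiding : ∀ {m k} → Subset k → (Fin m → Fin k) → Set
InjectionAvoiding A f = Injective _≡_ _≡_ f × (∀ i → f i ∉ A)

injectionAvoiding-suc : ∀ {m k} (A : Subset k) (f : Fin (suc m) → Fin k) →
                        (f zero ∉ A × InjectionAvoiding (A ∪ ⁅ f zero ⁆) (f ∘ suc)) ⇔ InjectionAvoiding A f
injectionAvoiding-suc A f = mk⇔ glue split
  where
  glue : f zero ∉ A × InjectionAvoiding (A ∪ ⁅ f zero ⁆) (f ∘ suc) → InjectionAvoiding A f
  glue (f₀∉A , tail-inj , tail-avoids) = injective , avoids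
    where
    tail≢f₀ : ∀ i → f (suc i) ≢ f zero
    tail≢f₀ i eq = tail-avoids i (x∈p∪q⁺ (inj₂ (subst (_∈ ⁅ f zero ⁆) (sym eq) (x∈⁅x⁆ (f zero)))))
    injective : Injective _≡_ _≡_ f
    injective {zero}  {zero}  _  = refl
    injective {zero}  {suc j} eq = contradiction (sym eq) (tail≢f₀ j)
    injective {suc i} {zero}  eq = contradiction eq (tail≢f₀ i)
    injective {suc i} {suc j} eq = cong suc (tail-inj eq)
    avoids : ∀ i → f i ∉ A
    avoids zero    = f₀∉A
    avoids (suc i) = tail-avoids i ∘ x∈p∪q⁺ ∘ inj₁
  split : InjectionAvoiding A f → f zero ∉ A × InjectionAvoiding (A ∪ ⁅ f zero ⁆) (f ∘ suc)
  split (injective , avoids) = avoids zero , suc-injective ∘ injective , tail-avoids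
    where
    tail-avoids : ∀ i → f (suc i) ∉ A ∪ ⁅ f zero ⁆
    tail-avoids i fᵢ∈ with x∈p∪q⁻ A ⁅ f zero ⁆ fᵢ∈
    ... | inj₁ fᵢ∈A   = avoids (suc i) fᵢ∈A
    ... | inj₂ fᵢ∈f₀  = contradiction (injective (x∈⁅y⁆⇒x≡y (f zero) fᵢ∈f₀)) λ ()

injectionAvoiding? : ∀ {m k} (A : Subset k) (f : Fin m → Fin k) → Dec (InjectionAvoiding A f)
injectionAvoiding? {zero}  A f = yes ((λ {}) , λ ())
injectionAvoiding? {suc m} A f =
  Dec.map (injectionAvoiding-suc A f) (¬? (f zero ∈? A) ×-dec injectionAvoiding? (A ∪ ⁅ f zero ⁆) (f ∘ suc))

fallingFactorial : ℕ → ℕ → ℕ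
fallingFactorial j zero    = 1
fallingFactorial j (suc m) = j * fallingFactorial (pred j) m

fallingFactorial-n-n : ∀ n → fallingFactorial n n ≡ n !
fallingFactorial-n-n zero    = refl
fallingFactorial-n-n (suc n) = cong (suc n *_) (fallingFactorial-n-n n)

∑-𝟙-∈ : ∀ {k} (A : Subset k) → ∑[ a ∈ allFin k ] 𝟙 (a ∈? A) ≡ ∣ A ∣
∑-𝟙-∈ []            = refl
∑-𝟙-∈ {suc k} (inside  ∷ A) = trans (∑-allFin-suc {k} (λ a → 𝟙 (a ∈? inside ∷ A))) (cong suc (∑-𝟙-∈ A))
∑-𝟙-∈ {suc k} (outside ∷ A) = trans (∑-allFin-suc {k} (λ a → 𝟙 (a ∈? outside ∷ A))) (∑-𝟙-∈ A)

∑-𝟙-∉ : ∀ {k} (A : Subset k) → ∑[ a ∈ allFin k ] 𝟙 (¬? (a ∈? A)) ≡ k ∸ ∣ A ∣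
∑-𝟙-∉ {k} A = begin
  ∑[ a ∈ allFin k ] 𝟙 (¬? (a ∈? A))  ≡⟨ ∑-cong (allFin k) (λ a → 𝟙-⇔ ∉⇔∈∁ (¬? (a ∈? A)) (a ∈? ∁ A)) ⟩
  ∑[ a ∈ allFin k ] 𝟙 (a ∈? ∁ A)     ≡⟨ ∑-𝟙-∈ (∁ A) ⟩
  ∣ ∁ A ∣                            ≡⟨ ∣∁p∣≡n∸∣p∣ A ⟩
  k ∸ ∣ A ∣                          ∎
  where
  open ≡-Reasoning
  ∉⇔∈∁ : ∀ {a} → a ∉ A ⇔ a ∈ ∁ A
  ∉⇔∈∁ = mk⇔ x∉p⇒x∈∁p x∈∁p⇒x∉p

∣p∪⁅x⁆∣≡1+∣p∣ : ∀ {k} {p : Subset k} {x : Fin k} → x ∉ p → ∣ p ∪ ⁅ x ⁆ ∣ ≡ suc ∣ p ∣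
∣p∪⁅x⁆∣≡1+∣p∣ {p = inside  ∷ p} {zero}  x∉p = contradiction here x∉p
∣p∪⁅x⁆∣≡1+∣p∣ {p = outside ∷ p} {zero}  x∉p = cong (suc ∘ ∣_∣) (∪-identityʳ p)
∣p∪⁅x⁆∣≡1+∣p∣ {p = inside  ∷ p} {suc x} x∉p = cong suc (∣p∪⁅x⁆∣≡1+∣p∣ (x∉p ∘ there))
∣p∪⁅x⁆∣≡1+∣p∣ {p = outside ∷ p} {suc x} x∉p = ∣p∪⁅x⁆∣≡1+∣p∣ (x∉p ∘ there)

∑-injectionAvoiding : ∀ m {k} (A : Subset k) →
                      ∑[ f ∈ allFunctions m k ] 𝟙 (injectionAvoiding? A f) ≡ fallingFactorial (k ∸ ∣ A ∣) m
∑-injectionAvoiding zero        A = refl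
∑-injectionAvoiding (suc m) {k} A = begin
  ∑[ f ∈ allFunctions (suc m) k ] 𝟙 (injectionAvoiding? A f)
    ≡⟨ ∑-allFunctions-suc (λ f → 𝟙 (injectionAvoiding? A f)) ⟩
  ∑[ a ∈ allFin k ] ∑[ g ∈ allFunctions m k ] 𝟙 (¬? (a ∈? A) ×-dec injectionAvoiding? (A ∪ ⁅ a ⁆) g)
    ≡⟨ ∑-cong (allFin k) (λ a → trans
         (∑-cong (allFunctions m k) (λ g → 𝟙-× (¬? (a ∈? A)) (injectionAvoiding? (A ∪ ⁅ a ⁆) g)))
         (∑-*ˡ (allFunctions m k) (𝟙 (¬? (a ∈? A))) _)) ⟩
  ∑[ a ∈ allFin k ] (𝟙 (¬? (a ∈? A)) * ∑[ g ∈ allFunctions m k ] 𝟙 (injectionAvoiding? (A ∪ ⁅ a ⁆) g))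
    ≡⟨ ∑-cong (allFin k) (λ a → cong (𝟙 (¬? (a ∈? A)) *_) (∑-injectionAvoiding m (A ∪ ⁅ a ⁆))) ⟩
  ∑[ a ∈ allFin k ] (𝟙 (¬? (a ∈? A)) * fallingFactorial (k ∸ ∣ A ∪ ⁅ a ⁆ ∣) m)
    ≡⟨ ∑-cong (allFin k) one-fewer ⟩
  ∑[ a ∈ allFin k ] (𝟙 (¬? (a ∈? A)) * fallingFactorial (pred (k ∸ ∣ A ∣)) m)
    ≡⟨ ∑-*ʳ (allFin k) _ (λ a → 𝟙 (¬? (a ∈? A))) ⟩
  ∑[ a ∈ allFin k ] 𝟙 (¬? (a ∈? A)) * fallingFactorial (pred (k ∸ ∣ A ∣)) m
    ≡⟨ cong (_* fallingFactorial (pred (k ∸ ∣ A ∣)) m) (∑-𝟙-∉ A) ⟩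
  fallingFactorial (k ∸ ∣ A ∣) (suc m) ∎
  where
  open ≡-Reasoning
  one-fewer : ∀ a → 𝟙 (¬? (a ∈? A)) * fallingFactorial (k ∸ ∣ A ∪ ⁅ a ⁆ ∣) m
                  ≡ 𝟙 (¬? (a ∈? A)) * fallingFactorial (pred (k ∸ ∣ A ∣)) m
  one-fewer a with a ∈? A
  ... | yes _   = refl
  ... | no  a∉A = cong (λ j → 1 * fallingFactorial j m)
                       (trans (cong (k ∸_) (∣p∪⁅x⁆∣≡1+∣p∣ a∉A)) (sym (pred[m∸n]≡m∸[1+n] k ∣ A ∣)))

injective? : ∀ {m k} (f : Fin m → Fin k) → Dec (Injective _≡_ _≡_ f)
injective? f = map′ proj₁ (λ injective → injective , λ _ → ∉⊥) (injectionAvoiding? ⊥ f)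

∑-injective : ∀ n → ∑[ f ∈ allFunctions n n ] 𝟙 (injective? f) ≡ n !
∑-injective n = begin
  ∑[ f ∈ allFunctions n n ] 𝟙 (injectionAvoiding? ⊥ f) ≡⟨ ∑-injectionAvoiding n ⊥ ⟩
  fallingFactorial (n ∸ ∣ ⊥ {n} ∣) n                   ≡⟨ cong (λ c → fallingFactorial (n ∸ c) n) (∣⊥∣≡0 n) ⟩
  fallingFactorial n n                                 ≡⟨ fallingFactorial-n-n n ⟩
  n !                                                  ∎
  where open ≡-Reasoning

-- Ranking in a strict order

rank : ∀ {n} {_◁_ : Rel (Fin n) 0ℓ} → Decidable _◁_ → Fin n → ℕ
rank {n} _◁?_ x = ∑[ y ∈ allFin n ] 𝟙 (y ◁? x)

rank-relabel : ∀ {n} {_◁_ : Rel (Fin n) 0ℓ} (_◁?_ : Decidable _◁_) (σ τ : Fin n → Fin n) →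
               (∀ x → τ (σ x) ≡ x) → (∀ y → σ (τ y) ≡ y) →
               ∀ x → rank (λ y z → σ y ◁? σ z) x ≡ rank _◁?_ (σ x)
rank-relabel _◁?_ σ τ τ∘σ σ∘τ x =
  Fins.∑-reindex (λ y → 𝟙 (y ◁? σ x)) (cong (λ y → 𝟙 (y ◁? σ x))) σ τ
    (λ y z → mk⇔ (λ y≡σz → trans (sym (τ∘σ z)) (cong τ (sym y≡σz)))
                 (λ z≡τy → trans (sym (σ∘τ y)) (cong σ (sym z≡τy))))

module Ranking {n} {_◁_ : Rel (Fin n) 0ℓ} (spo : IsStrictPartialOrder _≡_ _◁_) (_◁?_ : Decidable _◁_) where
  open IsStrictPartialOrder spo using (irrefl) renaming (trans to ◁-trans)

  rank<n : ∀ x → rank _◁?_ x < n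
  rank<n x = begin-strict
    ∑[ y ∈ allFin n ] 𝟙 (y ◁? x) <⟨ ∑-mono-< (λ y → 𝟙≤1 (y ◁? x))
                                             (lose {P = λ y → 𝟙 (y ◁? x) < 1} (∈-allFin x) 𝟙[x◁x]<1) ⟩
    ∑[ _ ∈ allFin n ] 1          ≡⟨ length≡∑ (allFin n) ⟨
    length (allFin n)            ≡⟨ length-tabulate {n = n} id ⟩
    n                            ∎
    where
    open ≤-Reasoning
    𝟙[x◁x]<1 : 𝟙 (x ◁? x) < 1
    𝟙[x◁x]<1 = subst (_< 1) (sym (𝟙-no (x ◁? x) (irrefl {x} refl))) (s≤s z≤n)

  rank-mono-< : ∀ {x y} → x ◁ y → rank _◁?_ x < rank _◁?_ y
  rank-mono-< {x} {y} x◁y = ∑-mono-< below (lose {P = λ z → 𝟙 (z ◁? x) < 𝟙 (z ◁? y)} (∈-allFin x) at-x)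
    where
    below : ∀ z → 𝟙 (z ◁? x) ≤ 𝟙 (z ◁? y)
    below z with z ◁? x
    ... | yes z◁x = ≤-reflexive (sym (𝟙-yes (z ◁? y) (◁-trans z◁x x◁y)))
    ... | no  _   = z≤n
    at-x : 𝟙 (x ◁? x) < 𝟙 (x ◁? y)
    at-x rewrite 𝟙-no (x ◁? x) (irrefl {x} refl) | 𝟙-yes (x ◁? y) x◁y = s≤s z≤n

  position : Fin n → Fin n
  position x = fromℕ< (rank<n x)

  toℕ-position : ∀ x → toℕ (position x) ≡ rank _◁?_ x
  toℕ-position x = toℕ-fromℕ< (rank<n x)

  position-mono-< : ∀ {x y} → x ◁ y → position x Fin.< position y
  position-mono-< {x} {y} x◁y = subst₂ _<_ (sym (toℕ-position x)) (sym (toℕ-position y)) (rank-mono-< x◁y)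

  module _ (compare : Trichotomous _≡_ _◁_) where
    position-cancel-< : ∀ {x y} → position x Fin.< position y → x ◁ y
    position-cancel-< {x} {y} px<py with compare x y
    ... | tri< x◁y _ _ = x◁y
    ... | tri≈ _ refl _ = contradiction px<py (<-irrefl refl)
    ... | tri> _ _ y◁x = contradiction px<py (<-asym (position-mono-< y◁x))

    position-injective : Injective _≡_ _≡_ position
    position-injective {x} {y} px≡py with compare x y
    ... | tri< x◁y _ _ = contradiction (position-mono-< x◁y) (<-irrefl (cong toℕ px≡py))
    ... | tri≈ _ x≡y _ = x≡y
    ... | tri> _ _ y◁x = contradiction (position-mono-< y◁x) (<-irrefl (cong toℕ (sym px≡py)))

private
  module Lex = StrictTotalOrder (×-strictTotalOrder <-strictTotalOrder <-strictTotalOrder)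

module LexOrder {n t : ℕ} (g : Fin n → Fin t) (π : Fin n → Fin n) where
  key : Fin n → ℕ × ℕ
  key x = toℕ (g x) , toℕ (π x)

  _◁_ : Rel (Fin n) 0ℓ
  x ◁ y = key x Lex.< key y

  _◁?_ : Decidable _◁_
  x ◁? y = key x Lex.<? key y

  ◁-isStrictPartialOrder : IsStrictPartialOrder _≡_ _◁_
  ◁-isStrictPartialOrder = record
    { isEquivalence = isEquivalence
    ; irrefl        = λ { refl → Lex.irrefl (refl , refl) }
    ; trans         = Lex.trans
    ; <-resp-≈      = resp₂ _◁_
    }

  ◁-compare : Injective _≡_ _≡_ π → Trichotomous _≡_ _◁_
  ◁-compare π-injective x y with Lex.compare (key x) (key y)
  ... | tri< x◁y ≉ ¬y◁x = tri< x◁y (λ { refl → ≉ (refl , refl) }) ¬y◁x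
  ... | tri≈ ¬x◁y (_ , πx≡πy) ¬y◁x = tri≈ ¬x◁y (π-injective (toℕ-injective πx≡πy)) ¬y◁x
  ... | tri> ¬x◁y ≉ y◁x = tri> ¬x◁y (λ { refl → ≉ (refl , refl) }) y◁x

  open Ranking ◁-isStrictPartialOrder _◁?_ public

rankBy : ∀ {n t} → (Fin n → Fin t) → (Fin n → Fin n) → Fin n → Fin n
rankBy g π = LexOrder.position g π

module _ {n t : ℕ} where
  rankBy-cong : ∀ {g g' : Fin n → Fin t} {π π' : Fin n → Fin n} → g ≗ g' → π ≗ π' → rankBy g π ≗ rankBy g' π'
  rankBy-cong {g} {g'} {π} {π'} g≗g' π≗π' x =
    fromℕ<-cong _ _ (∑-cong (allFin n) (λ y → cong₂ (λ a b → 𝟙 (a Lex.<? b)) (key≡ y) (key≡ x))) _ _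
    where
    key≡ : ∀ y → LexOrder.key g π y ≡ LexOrder.key g' π' y
    key≡ y = cong₂ _,_ (cong toℕ (g≗g' y)) (cong toℕ (π≗π' y))

  rankBy-relabel : ∀ (g : Fin n → Fin t) π (σ τ : Fin n → Fin n) →
                   (∀ x → τ (σ x) ≡ x) → (∀ y → σ (τ y) ≡ y) → rankBy (g ∘ σ) (π ∘ σ) ≗ rankBy g π ∘ σ
  rankBy-relabel g π σ τ τ∘σ σ∘τ x = toℕ-injective (begin
    toℕ (rankBy (g ∘ σ) (π ∘ σ) x)        ≡⟨ LexOrder.toℕ-position (g ∘ σ) (π ∘ σ) x ⟩
    rank (LexOrder._◁?_ (g ∘ σ) (π ∘ σ)) x ≡⟨ rank-relabel (LexOrder._◁?_ g π) σ τ τ∘σ σ∘τ x ⟩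
    rank (LexOrder._◁?_ g π) (σ x)         ≡⟨ LexOrder.toℕ-position g π (σ x) ⟨
    toℕ (rankBy g π (σ x))                 ∎)
    where open ≡-Reasoning

  module _ (g : Fin n → Fin t) {π : Fin n → Fin n} (π-injective : Injective _≡_ _≡_ π) where
    rankBy-injective : Injective _≡_ _≡_ (rankBy g π)
    rankBy-injective = LexOrder.position-injective g π (LexOrder.◁-compare g π π-injective)

    rankBy-cancel-< : ∀ {x y} → rankBy g π x Fin.< rankBy g π y → g x Fin.≤ g y
    rankBy-cancel-< rx<ry with LexOrder.position-cancel-< g π (LexOrder.◁-compare g π π-injective) rx<ry
    ... | inj₁ gx<gy       = <⇒≤ gx<gy
    ... | inj₂ (gx≡gy , _) = ≤-reflexive gx≡gy

  rankBy-tie-< : ∀ (g : Fin n → Fin t) π {x y} → g x ≡ g y → π x Fin.< π y → rankBy g π x Fin.< rankBy g π y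
  rankBy-tie-< g π gx≡gy πx<πy = LexOrder.position-mono-< g π (inj₂ (cong toℕ gx≡gy , πx<πy))

-- Fibres of sorting

module Inverse {n} {f : Fin n → Fin n} (f-injective : Injective _≡_ _≡_ f) where
  f⁻¹ : Fin n → Fin n
  f⁻¹ y = proj₁ (injective⇒surjective f-injective y)

  f∘f⁻¹ : ∀ y → f (f⁻¹ y) ≡ y
  f∘f⁻¹ y = proj₂ (injective⇒surjective f-injective y)

  f⁻¹∘f : ∀ x → f⁻¹ (f x) ≡ x
  f⁻¹∘f x = f-injective (f∘f⁻¹ (f x))

  ∘f⁻¹-⇔ : ∀ {X : Set} (a b : Fin n → X) → a ≗ b ∘ f⁻¹ ⇔ b ≗ a ∘ f
  ∘f⁻¹-⇔ a b = mk⇔ (λ a≗b∘f⁻¹ x → trans (cong b (sym (f⁻¹∘f x))) (sym (a≗b∘f⁻¹ (f x))))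
                   (λ b≗a∘f y → trans (cong a (sym (f∘f⁻¹ y))) (sym (b≗a∘f (f⁻¹ y))))

  injective-∘f⁻¹ : ∀ {π : Fin n → Fin n} → Injective _≡_ _≡_ π ⇔ Injective _≡_ _≡_ (π ∘ f⁻¹)
  injective-∘f⁻¹ {π} = mk⇔
    (λ π-inj {x} {y} eq → trans (sym (f∘f⁻¹ x)) (trans (cong f (π-inj eq)) (f∘f⁻¹ y)))
    (λ πf⁻¹-inj {x} {y} eq → f-injective (πf⁻¹-inj
       (trans (cong π (f⁻¹∘f x)) (trans eq (cong π (sym (f⁻¹∘f y)))))))

injective-≗ : ∀ {m k} {π π' : Fin m → Fin k} → π ≗ π' → Injective _≡_ _≡_ π → Injective _≡_ _≡_ π'
injective-≗ π≗π' π-injective eq = π-injective (trans (π≗π' _) (trans eq (sym (π≗π' _))))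

𝟙-injective?-cong : ∀ {n} {π π' : Fin n → Fin n} → π ≗ π' → 𝟙 (injective? π) ≡ 𝟙 (injective? π')
𝟙-injective?-cong {π = π} {π'} π≗π' =
  𝟙-⇔ (mk⇔ (injective-≗ π≗π') (injective-≗ (sym ∘ π≗π'))) (injective? π) (injective? π')

𝟙-≗?-congʳ : ∀ {n t} (f : Fin n → Fin t) {h h' : Fin n → Fin t} → h ≗ h' → 𝟙 (f ≗? h) ≡ 𝟙 (f ≗? h')
𝟙-≗?-congʳ f {h} {h'} h≗h' =
  𝟙-⇔ (mk⇔ (λ f≗h x → trans (f≗h x) (h≗h' x)) (λ f≗h' x → trans (f≗h' x) (sym (h≗h' x)))) (f ≗? h) (f ≗? h')

module Fibres (n t : ℕ) where
  private
    Xt = allFunctions n t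
    XX = allFunctions n n

  fibre : (Fin n → Fin n) → ℕ
  fibre f = ∑[ g ∈ Xt ] ∑[ π ∈ XX ] (𝟙 (f ≗? rankBy g π) * 𝟙 (injective? π))

  ∑-fibre : (w : (Fin n → Fin n) → ℕ) → w Preserves _≗_ ⟶ _≡_ →
            ∑[ g ∈ Xt ] ∑[ π ∈ XX ] (𝟙 (injective? π) * w (rankBy g π)) ≡ ∑[ f ∈ XX ] (w f * fibre f)
  ∑-fibre w w-cong = begin
    ∑[ g ∈ Xt ] ∑[ π ∈ XX ] (𝟙 (injective? π) * w (rankBy g π))
      ≡⟨ ∑-cong Xt (λ g → ∑-cong XX (λ π → Functions.∑-select (λ f → 𝟙 (injective? π) * w f)
                                              (cong (𝟙 (injective? π) *_) ∘ w-cong) (rankBy g π))) ⟨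
    ∑[ g ∈ Xt ] ∑[ π ∈ XX ] ∑[ f ∈ XX ] (𝟙 (f ≗? rankBy g π) * (𝟙 (injective? π) * w f))
      ≡⟨ ∑-cong Xt (λ g → ∑-comm XX XX _) ⟩
    ∑[ g ∈ Xt ] ∑[ f ∈ XX ] ∑[ π ∈ XX ] (𝟙 (f ≗? rankBy g π) * (𝟙 (injective? π) * w f))
      ≡⟨ ∑-comm Xt XX _ ⟩
    ∑[ f ∈ XX ] ∑[ g ∈ Xt ] ∑[ π ∈ XX ] (𝟙 (f ≗? rankBy g π) * (𝟙 (injective? π) * w f))
      ≡⟨ ∑-cong XX (λ f → ∑-cong Xt (λ g → ∑-cong XX (λ π → rotate (𝟙 (f ≗? rankBy g π)) _ (w f)))) ⟩
    ∑[ f ∈ XX ] ∑[ g ∈ Xt ] ∑[ π ∈ XX ] (w f * (𝟙 (f ≗? rankBy g π) * 𝟙 (injective? π)))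
      ≡⟨ ∑-cong XX (λ f → trans (∑-cong Xt (λ g → ∑-*ˡ XX (w f) _)) (∑-*ˡ Xt (w f) _)) ⟩
    ∑[ f ∈ XX ] (w f * fibre f) ∎
    where
    open ≡-Reasoning
    rotate : ∀ a b c → a * (b * c) ≡ c * (a * b)
    rotate a b c = trans (sym (*-assoc a b c)) (*-comm (a * b) c)

  fibre-relabel : ∀ {f} → Injective _≡_ _≡_ f → fibre f ≡ fibre id
  fibre-relabel {f} f-injective = begin
    fibre f
      ≡⟨ ∑-cong Xt (λ g → ∑-cong XX (λ π → relabel g π)) ⟨
    ∑[ g ∈ Xt ] ∑[ π ∈ XX ] (𝟙 (id ≗? rankBy (g ∘ f⁻¹) (π ∘ f⁻¹)) * 𝟙 (injective? (π ∘ f⁻¹)))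
      ≡⟨ ∑-cong Xt (λ g → Functions.∑-reindex (G g) (G-cong g) (_∘ f⁻¹) (_∘ f) ∘f⁻¹-⇔) ⟩
    ∑[ g ∈ Xt ] ∑[ π ∈ XX ] (𝟙 (id ≗? rankBy (g ∘ f⁻¹) π) * 𝟙 (injective? π))
      ≡⟨ Functions.∑-reindex F F-cong (_∘ f⁻¹) (_∘ f) ∘f⁻¹-⇔ ⟩
    fibre id ∎
    where
    open ≡-Reasoning
    open Inverse f-injective
    F : (Fin n → Fin t) → ℕ
    F g = ∑[ π ∈ XX ] (𝟙 (id ≗? rankBy g π) * 𝟙 (injective? π))
    F-cong : F Preserves _≗_ ⟶ _≡_
    F-cong g≗g' = ∑-cong XX (λ π → cong (_* 𝟙 (injective? π)) (𝟙-≗?-congʳ id (rankBy-cong g≗g' (λ _ → refl))))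
    G : (Fin n → Fin t) → (Fin n → Fin n) → ℕ
    G g π = 𝟙 (id ≗? rankBy (g ∘ f⁻¹) π) * 𝟙 (injective? π)
    G-cong : ∀ g → G g Preserves _≗_ ⟶ _≡_
    G-cong g π≗π' = cong₂ _*_ (𝟙-≗?-congʳ id (rankBy-cong {g = g ∘ f⁻¹} (λ _ → refl) π≗π'))
                              (𝟙-injective?-cong π≗π')
    id≗∘f⁻¹-⇔ : ∀ h → id ≗ h ∘ f⁻¹ ⇔ f ≗ h
    id≗∘f⁻¹-⇔ h = mk⇔ (λ id≗ x → sym (Equivalence.to (∘f⁻¹-⇔ id h) id≗ x))
                      (λ f≗h → Equivalence.from (∘f⁻¹-⇔ id h) (sym ∘ f≗h))
    relabel : ∀ g π → 𝟙 (id ≗? rankBy (g ∘ f⁻¹) (π ∘ f⁻¹)) * 𝟙 (injective? (π ∘ f⁻¹))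
                    ≡ 𝟙 (f ≗? rankBy g π) * 𝟙 (injective? π)
    relabel g π = cong₂ _*_
      (trans (𝟙-≗?-congʳ id (rankBy-relabel g π f⁻¹ f f∘f⁻¹ f⁻¹∘f))
             (𝟙-⇔ (id≗∘f⁻¹-⇔ (rankBy g π)) (id ≗? (rankBy g π ∘ f⁻¹)) (f ≗? rankBy g π)))
      (𝟙-⇔ (mk⇔ (Equivalence.from injective-∘f⁻¹) (Equivalence.to injective-∘f⁻¹))
           (injective? (π ∘ f⁻¹)) (injective? π))

  ∑-injective-fibre : ∑[ f ∈ XX ] (𝟙 (injective? f) * fibre f) ≡ t ^ n * n !
  ∑-injective-fibre = begin
    ∑[ f ∈ XX ] (𝟙 (injective? f) * fibre f)
      ≡⟨ ∑-fibre (λ f → 𝟙 (injective? f)) 𝟙-injective?-cong ⟨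
    ∑[ g ∈ Xt ] ∑[ π ∈ XX ] (𝟙 (injective? π) * 𝟙 (injective? (rankBy g π)))
      ≡⟨ ∑-cong Xt (λ g → ∑-cong XX (rankBy-injective-𝟙 g)) ⟩
    ∑[ g ∈ Xt ] ∑[ π ∈ XX ] 𝟙 (injective? π)
      ≡⟨ ∑-cong Xt (λ _ → ∑-injective n) ⟩
    ∑[ _ ∈ Xt ] (n !)
      ≡⟨ ∑-const Xt (n !) ⟩
    length Xt * n !
      ≡⟨ cong (_* n !) (length-allFunctions n t) ⟩
    t ^ n * n ! ∎
    where
    open ≡-Reasoning
    rankBy-injective-𝟙 : ∀ g π → 𝟙 (injective? π) * 𝟙 (injective? (rankBy g π)) ≡ 𝟙 (injective? π)
    rankBy-injective-𝟙 g π = trans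
      (𝟙-*-cong (injective? π) λ π-injective →
         𝟙-yes (injective? (rankBy g π)) (rankBy-injective g π-injective))
      (*-identityʳ (𝟙 (injective? π)))

  fibre-id : fibre id ≡ t ^ n
  fibre-id = *-cancelˡ-≡ (fibre id) (t ^ n) (n !) {{n !≢0}} (begin
    n ! * fibre id                            ≡⟨ cong (_* fibre id) (∑-injective n) ⟨
    ∑[ f ∈ XX ] 𝟙 (injective? f) * fibre id   ≡⟨ ∑-*ʳ XX (fibre id) (λ f → 𝟙 (injective? f)) ⟨
    ∑[ f ∈ XX ] (𝟙 (injective? f) * fibre id) ≡⟨ ∑-cong XX relabel ⟩
    ∑[ f ∈ XX ] (𝟙 (injective? f) * fibre f)  ≡⟨ ∑-injective-fibre ⟩
    t ^ n * n !                               ≡⟨ *-comm (t ^ n) (n !) ⟩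
    n ! * t ^ n                               ∎)
    where
    open ≡-Reasoning
    relabel : ∀ f → 𝟙 (injective? f) * fibre id ≡ 𝟙 (injective? f) * fibre f
    relabel f = 𝟙-*-cong (injective? f) (sym ∘ fibre-relabel)

  fibre-injective : ∀ {f} → Injective _≡_ _≡_ f → fibre f ≡ t ^ n
  fibre-injective f-injective = trans (fibre-relabel f-injective) fibre-id

  ∑-rankBy : (w : (Fin n → Fin n) → ℕ) → w Preserves _≗_ ⟶ _≡_ → (∀ f → ¬ Injective _≡_ _≡_ f → w f ≡ 0) →
             ∑[ g ∈ Xt ] ∑[ π ∈ XX ] (𝟙 (injective? π) * w (rankBy g π)) ≡ ∑ XX w * t ^ n
  ∑-rankBy w w-cong w-vanishes = trans (∑-fibre w w-cong) (trans (∑-cong XX fibre-size) (∑-*ʳ XX (t ^ n) w))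
    where
    fibre-size : ∀ f → w f * fibre f ≡ w f * t ^ n
    fibre-size f with injective? f
    ... | yes f-injective = cong (w f *_) (fibre-injective f-injective)
    ... | no  ¬injective  = trans (cong (_* fibre f) (w-vanishes f ¬injective))
                                  (sym (cong (_* t ^ n) (w-vanishes f ¬injective)))

reversing-injection : ∀ {n} {a b : Fin n} → a ≢ b → ∃ λ π → Injective _≡_ _≡_ π × π b Fin.< π a
reversing-injection {n} {a} {b} a≢b with <-cmp (toℕ a) (toℕ b)
... | tri< a<b _ _ = opposite , opposite-injective , reversed
  where
  opposite-injective : Injective _≡_ _≡_ (opposite {n})
  opposite-injective {x} {y} eq =
    trans (sym (opposite-involutive x)) (trans (cong opposite eq) (opposite-involutive y))
  reversed : opposite b Fin.< opposite a
  reversed rewrite opposite-prop a | opposite-prop b = ∸-monoʳ-< (s≤s a<b) (toℕ<n b)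
... | tri≈ _ a≡b _ = contradiction (toℕ-injective a≡b) a≢b
... | tri> _ _ b<a = id , id , b<a

module _ {n : ℕ} (_≺_ : Rel (Fin n) 0ℓ) (_≺?_ : Decidable _≺_) where
  private
    Linear : (Fin n → Fin n) → Set
    Linear = LinearExtension _≺_ _≺?_

    Preserving : ∀ {t} → (Fin n → Fin t) → Set
    Preserving = OrderPreserving _≺_ _≺?_

    linear? : ∀ f → Dec (Linear f)
    linear? = linearExtension? _≺_ _≺?_

    preserving? : ∀ {t} (g : Fin n → Fin t) → Dec (Preserving g)
    preserving? = orderPreserving? _≺_ _≺?_

    𝟙-linearExtension : (Fin n → Fin n) → ℕ
    𝟙-linearExtension f = 𝟙 (linear? f)

    𝟙-orderPreserving : ∀ {t} → (Fin n → Fin t) → ℕ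
    𝟙-orderPreserving g = 𝟙 (preserving? g)

  𝟙-linearExtension-cong : 𝟙-linearExtension Preserves _≗_ ⟶ _≡_
  𝟙-linearExtension-cong {f} {f'} f≗f' =
    𝟙-⇔ (mk⇔ (transfer f≗f') (transfer (sym ∘ f≗f'))) (linear? f) (linear? f')
    where
    transfer : ∀ {h h'} → h ≗ h' → Linear h → Linear h'
    transfer h≗h' ((injective , surjective) , monotone) =
      ( (λ x y eq → injective x y (trans (h≗h' x) (trans eq (sym (h≗h' y)))))
      , (λ y → proj₁ (surjective y) , trans (sym (h≗h' _)) (proj₂ (surjective y))) )
      , λ x y x≺y → subst₂ Fin._<_ (h≗h' x) (h≗h' y) (monotone x y x≺y)

  linearExtension⇒injective : ∀ {f} → Linear f → Injective _≡_ _≡_ f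
  linearExtension⇒injective ((injective , _) , _) = injective _ _

  orderPreserving-of-rankBy : ∀ {t} (g : Fin n → Fin t) {π} → Injective _≡_ _≡_ π →
                              Linear (rankBy g π) → Preserving g
  orderPreserving-of-rankBy g π-injective (_ , monotone) x y x≺y =
    rankBy-cancel-< g π-injective (monotone x y x≺y)

  rankBy-weight-≤ : ∀ {t} (g : Fin n → Fin t) π →
                    𝟙 (injective? π) * 𝟙-linearExtension (rankBy g π) ≤ 𝟙 (injective? π) * 𝟙-orderPreserving g
  rankBy-weight-≤ g π = 𝟙-*-mono-≤ (injective? π) (λ π-injective →
    𝟙-mono-≤ (orderPreserving-of-rankBy g π-injective) (linear? (rankBy g π)) (preserving? g))

  rankBy-weight-< : ∀ {t a b} → a ≺ b → (g : Fin n → Fin t) → (∀ x y → g x ≡ g y) →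
                    ∀ {π} → Injective _≡_ _≡_ π → π b Fin.< π a →
                    𝟙 (injective? π) * 𝟙-linearExtension (rankBy g π) < 𝟙 (injective? π) * 𝟙-orderPreserving g
  rankBy-weight-< {a = a} {b} a≺b g g-constant {π} π-injective πb<πa =
    subst₂ _<_ (sym (cong₂ _*_ (𝟙-yes (injective? π) π-injective) (𝟙-no (linear? (rankBy g π)) ¬linear)))
               (sym (cong₂ _*_ (𝟙-yes (injective? π) π-injective) (𝟙-yes (preserving? g) preserving)))
               (s≤s z≤n)
    where
    ¬linear : ¬ Linear (rankBy g π)
    ¬linear (_ , monotone) = <-asym (monotone a b a≺b) (rankBy-tie-< g π (g-constant b a) πb<πa)
    preserving : Preserving g
    preserving x y _ = ≤-reflexive (cong toℕ (g-constant x y))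

  module _ (t : ℕ) where
    open Fibres n t
    private
      Xt = allFunctions n t
      XX = allFunctions n n

    ∑-rankBy-linearExtension : ∑[ g ∈ Xt ] ∑[ π ∈ XX ] (𝟙 (injective? π) * 𝟙-linearExtension (rankBy g π))
                             ≡ e _≺_ _≺?_ * t ^ n
    ∑-rankBy-linearExtension = trans
      (∑-rankBy 𝟙-linearExtension 𝟙-linearExtension-cong
        (λ f ¬injective → 𝟙-no (linear? f) (¬injective ∘ linearExtension⇒injective)))
      (cong (_* t ^ n) (sym (length-filter XX (linear?))))

    ∑-orderPreserving : ∑[ g ∈ Xt ] ∑[ π ∈ XX ] (𝟙 (injective? π) * 𝟙-orderPreserving g) ≡ Ω _≺_ _≺?_ t * n !
    ∑-orderPreserving = begin
      ∑[ g ∈ Xt ] ∑[ π ∈ XX ] (𝟙 (injective? π) * 𝟙-orderPreserving g)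
        ≡⟨ ∑-cong Xt (λ g → trans (∑-*ʳ XX _ (λ π → 𝟙 (injective? π)))
                                  (cong (_* 𝟙-orderPreserving g) (∑-injective n))) ⟩
      ∑[ g ∈ Xt ] (n ! * 𝟙-orderPreserving g)   ≡⟨ ∑-*ˡ Xt (n !) 𝟙-orderPreserving ⟩
      n ! * ∑ Xt 𝟙-orderPreserving             ≡⟨ cong (n ! *_) (length-filter Xt (preserving?)) ⟨
      n ! * Ω _≺_ _≺?_ t                       ≡⟨ *-comm (n !) _ ⟩
      Ω _≺_ _≺?_ t * n !                       ∎
      where open ≡-Reasoning

  e*tⁿ<Ω*n! : ∀ {a b} → a ≢ b → a ≺ b → ∀ t → e _≺_ _≺?_ * suc t ^ n < Ω _≺_ _≺?_ (suc t) * n !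
  e*tⁿ<Ω*n! {a} {b} a≢b a≺b t = begin-strict
    e _≺_ _≺?_ * suc t ^ n
      ≡⟨ ∑-rankBy-linearExtension (suc t) ⟨
    ∑[ g ∈ Xt ] ∑[ π ∈ XX ] (𝟙 (injective? π) * 𝟙-linearExtension (rankBy g π))
      <⟨ ∑-mono-< (λ g → ∑-mono-≤ XX (rankBy-weight-≤ g))
                  (Any.map strict-at-constant (Functions.∈-enumeration (λ _ → zero))) ⟩
    ∑[ g ∈ Xt ] ∑[ π ∈ XX ] (𝟙 (injective? π) * 𝟙-orderPreserving g)
      ≡⟨ ∑-orderPreserving (suc t) ⟩
    Ω _≺_ _≺?_ (suc t) * n ! ∎
    where
    open ≤-Reasoning
    Xt = allFunctions n (suc t)
    XX = allFunctions n n
    π₀ = reversing-injection a≢b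
    strict-at-constant : ∀ {g} → g ≗ (λ _ → zero) →
      ∑[ π ∈ XX ] (𝟙 (injective? π) * 𝟙-linearExtension (rankBy g π))
        < ∑[ π ∈ XX ] (𝟙 (injective? π) * 𝟙-orderPreserving g)
    strict-at-constant {g} g≗0 = ∑-mono-< (rankBy-weight-≤ g) (Any.map
      (λ π≗π₀ → rankBy-weight-< a≺b g (λ x y → trans (g≗0 x) (sym (g≗0 y)))
                   (injective-≗ (sym ∘ π≗π₀) (proj₁ (proj₂ π₀)))
                   (subst₂ Fin._<_ (sym (π≗π₀ b)) (sym (π≗π₀ a)) (proj₂ (proj₂ π₀))))
      (Functions.∈-enumeration (proj₁ π₀)))

  Ω-one : Ω _≺_ _≺?_ 1 ≡ 1
  Ω-one = begin
    Ω _≺_ _≺?_ 1                               ≡⟨ length-filter (allFunctions n 1) preserving? ⟩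
    ∑[ g ∈ allFunctions n 1 ] 𝟙-orderPreserving g ≡⟨ ∑-cong (allFunctions n 1) all-preserving ⟩
    ∑[ _ ∈ allFunctions n 1 ] 1                ≡⟨ length≡∑ (allFunctions n 1) ⟨
    length (allFunctions n 1)                  ≡⟨ length-allFunctions n 1 ⟩
    1 ^ n                                      ≡⟨ ^-zeroˡ n ⟩
    1                                          ∎
    where
    open ≡-Reasoning
    all-preserving : (g : Fin n → Fin 1) → 𝟙-orderPreserving g ≡ 1
    all-preserving g = 𝟙-yes (preserving? g) λ x y _ → ≤-trans (toℕ≤pred[n] (g x)) z≤n

  e-discrete : (∀ x y → ¬ x ≺ y) → e _≺_ _≺?_ ≡ n !
  e-discrete discrete = begin
    e _≺_ _≺?_                                   ≡⟨ length-filter (allFunctions n n) linear? ⟩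
    ∑[ f ∈ allFunctions n n ] 𝟙-linearExtension f ≡⟨ ∑-cong (allFunctions n n) linear≡injective ⟩
    ∑[ f ∈ allFunctions n n ] 𝟙 (injective? f)   ≡⟨ ∑-injective n ⟩
    n !                                          ∎
    where
    open ≡-Reasoning
    linear⇔injective : ∀ {f} → Linear f ⇔ Injective _≡_ _≡_ f
    linear⇔injective = mk⇔ linearExtension⇒injective
      (λ injective → ((λ _ _ → injective) , injective⇒surjective injective)
                   , λ x y x≺y → contradiction x≺y (discrete x y))
    linear≡injective : ∀ f → 𝟙-linearExtension f ≡ 𝟙 (injective? f)
    linear≡injective f = 𝟙-⇔ linear⇔injective (linear? f) (injective? f)

corollary6p3 : (n : ℕ) (_≺_ : Rel (Fin n) 0ℓ) → IsStrictPartialOrder _≡_ _≺_ →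
    (_≺?_ : Decidable _≺_) →
    (∃[ t ] (t ≥ 1 × Ω _≺_ _≺?_ t * n ! ≡ e _≺_ _≺?_ * t ^ n))
      ⇔ Antichain _≺_ _≺?_
corollary6p3 n _≺_ spo _≺?_ = mk⇔ equality⇒antichain antichain⇒equality
  where
  equality⇒antichain : ∃[ t ] (t ≥ 1 × Ω _≺_ _≺?_ t * n ! ≡ e _≺_ _≺?_ * t ^ n) → Antichain _≺_ _≺?_
  equality⇒antichain (zero  , ()    , _)
  equality⇒antichain (suc t , _ , Ω*n!≡e*tⁿ) a b a≢b a≺b =
    <-irrefl (sym Ω*n!≡e*tⁿ) (e*tⁿ<Ω*n! _≺_ _≺?_ a≢b a≺b t)

  antichain⇒equality : Antichain _≺_ _≺?_ → ∃[ t ] (t ≥ 1 × Ω _≺_ _≺?_ t * n ! ≡ e _≺_ _≺?_ * t ^ n)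
  antichain⇒equality antichain = 1 , s≤s z≤n , (begin
    Ω _≺_ _≺?_ 1 * n !     ≡⟨ cong (_* n !) (Ω-one _≺_ _≺?_) ⟩
    1 * n !                ≡⟨ *-identityˡ (n !) ⟩
    n !                    ≡⟨ e-discrete _≺_ _≺?_ discrete ⟨
    e _≺_ _≺?_             ≡⟨ *-identityʳ _ ⟨
    e _≺_ _≺?_ * 1         ≡⟨ cong (e _≺_ _≺?_ *_) (^-zeroˡ n) ⟨
    e _≺_ _≺?_ * 1 ^ n     ∎)
    where
    open ≡-Reasoning
    discrete : ∀ x y → ¬ x ≺ y
    discrete x y x≺y = antichain x y (λ x≡y → IsStrictPartialOrder.irrefl spo x≡y x≺y) x≺y
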